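{- Let $S\subseteq \mathbb{N}^d$ be a generalized numerical semigroup. Then $S$ is irreducible if and only if there exists $\mathbf{f}\in H(S)$ such that for every $\mathbf{h}\in H(S)$ with $2\mathbf{h}\neq\mathbf{f}$ we have $\mathbf{f}-\mathbf{h}\in S$.
   Context: A generalized numerical semigroup (GNS) is a submonoid $S\subseteq\mathbb{N}^d$ such that $H(S)=\mathbb{N}^d\setminus S$ is finite. $S$ is irreducible if it cannot be expressed as the intersection of two GNSs each properly containing $S$. -}

module Defs where

open import Level using (0ℓ)
open import Data.Nat using (ℕ; _+_; _∸_; _≤_)
open import Data.Vec using (Vec; replicate; zipWith)
open import Data.Vec.Relation.Binary.Pointwise.Inductive using (Pointwise)
open import Data.List using (List)
open import Data.List.Membership.Propositional using (_∈_)
open import Data.Product using (Σ; ∃; _×_)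
open import Data.Sum using (_⊎_)
open import Relation.Nullary using (¬_)
open import Relation.Unary using (Pred)
open import Relation.Binary.PropositionalEquality using (_≡_)

Point : ℕ → Set
Point d = Vec ℕ d

𝟎 : ∀ {d} → Point d
𝟎 {d} = replicate d 0

infixl 6 _+ᵛ_ _∸ᵛ_
_+ᵛ_ : ∀ {d} → Point d → Point d → Point d
_+ᵛ_ = zipWith _+_

-- componentwise truncated subtraction (only used when the second argument is ≤ the first)
_∸ᵛ_ : ∀ {d} → Point d → Point d → Point d
_∸ᵛ_ = zipWith _∸_

infix 4 _≤ᵛ_
_≤ᵛ_ : ∀ {d} → Point d → Point d → Set
_≤ᵛ_ = Pointwise _≤_

Subset : ℕ → Set₁
Subset d = Pred (Point d) 0ℓ

H : ∀ {d} → Subset d → Subset d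
H S x = ¬ S x

record IsGNS {d : ℕ} (S : Subset d) : Set where
  field
    zero∈   : S 𝟎
    +-closed : ∀ x y → S x → S y → S (x +ᵛ y)
    holes   : List (Point d)
    holes⊆H : ∀ x → x ∈ holes → H S x
    H⊆holes : ∀ x → S x ⊎ x ∈ holes

_⊂_ : ∀ {d} → Subset d → Subset d → Set
S ⊂ T = (∀ x → S x → T x) × ∃ λ x → T x × ¬ S x

IsIntersection : ∀ {d} → Subset d → Subset d → Subset d → Set
IsIntersection S T U = ∀ x → (S x → T x × U x) × (T x × U x → S x)

Irreducible : ∀ {d} → Subset d → Set₁
Irreducible {d} S =
  ¬ (Σ (Subset d) λ T → Σ (Subset d) λ U →
       IsGNS T × IsGNS U × S ⊂ T × S ⊂ U × IsIntersection S T U)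

module Submission where

-- Call a gap g of S special when S ∪ {g} is again a GNS, i.e. g + s ∈ S for
-- every nonzero s ∈ S and 2g ∈ S.  Two distinct special gaps f, m exhibit S
-- as the intersection (S ∪ {f}) ∩ (S ∪ {m}), so an irreducible S has at most
-- one special gap.
--
-- (⇒) Measure points by their coordinate sum ∣_∣.  A gap f of maximal norm is
-- special.  Call a gap h bad (for f) when 2h ≠ f and f − h ∉ S.  If some bad
-- gap existed, a bad gap m of maximal norm would also be special (every gap of
-- larger norm is not bad, and a short case analysis turns this into m + s ∈ S
-- and 2m ∈ S); as m ≠ f this contradicts irreducibility.  Decidability of
-- membership in a GNS (its complement is a finite list) makes the maxima exist
-- and turns "no bad gap" into the positive condition.
--
-- (⇐) If f satisfies the condition, every additively closed T ⊇ S containing a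
-- gap x of S contains f: either f = 2x or f = x + (f − x) with f − x ∈ S.  Hence
-- two proper GNS over-monoids of S both contain the gap f, and their
-- intersection is not S.

open import Defs
open import Level using (0ℓ)
open import Data.Nat using (ℕ; _+_; _≤_; _<_; _≟_; _≤?_)
open import Data.Nat.Properties
  using ( +-comm; +-identityʳ; +-cancelˡ-≡; m+n≡0⇒m≡0; m+n≡0⇒n≡0; m<m+n
        ; +-assoc; n≢0⇒n>0; m+[n∸m]≡n; m+n∸m≡n; m≤m+n; <-irrefl; <⇒≱
        ; +-commutativeSemigroup )
open import Algebra.Properties.CommutativeSemigroup +-commutativeSemigroup
  using (interchange)
open import Data.Vec using ([]; _∷_; head; tail; sum)
open import Data.Vec.Properties using (≡-dec)
open import Data.Vec.Relation.Binary.Pointwise.Inductive as Pointwise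
  using ([]; _∷_; Pointwise-≡⇒≡; zipWith-comm; zipWith-assoc; zipWith-identityʳ)
open import Data.List using (List; filter)
open import Data.List.Membership.Propositional using (_∈_)
open import Data.List.Membership.Propositional.Properties using (∈-filter⁺; ∈-filter⁻)
open import Data.List.Relation.Unary.All using (lookup)
open import Data.List.Relation.Unary.All.Properties using (all-filter)
open import Data.List.Extrema.Nat using (argmax; argmax-all; f[xs]≤f[argmax])
open import Data.Product using (∃; _×_; _,_; proj₁; proj₂)
open import Data.Sum using (_⊎_; inj₁; inj₂)
open import Data.Empty using (⊥-elim)
open import Relation.Nullary using (¬_; Dec; yes; no)
open import Relation.Nullary.Decidable using (_×-dec_; _⊎-dec_; ¬?)
open import Relation.Unary using (Pred; Decidable)
open import Relation.Binary.PropositionalEquality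
  using (_≡_; _≢_; refl; sym; trans; cong; cong₂; subst; module ≡-Reasoning)
open import Function.Bundles using (_⇔_; mk⇔)

private
  variable
    d : ℕ

+ᵛ-comm : (x y : Point d) → x +ᵛ y ≡ y +ᵛ x
+ᵛ-comm x y = Pointwise-≡⇒≡ (zipWith-comm +-comm x y)

+ᵛ-assoc : (x y z : Point d) → (x +ᵛ y) +ᵛ z ≡ x +ᵛ (y +ᵛ z)
+ᵛ-assoc x y z = Pointwise-≡⇒≡ (zipWith-assoc +-assoc x y z)

+ᵛ-identityʳ : (x : Point d) → x +ᵛ 𝟎 ≡ x
+ᵛ-identityʳ x = Pointwise-≡⇒≡ (zipWith-identityʳ +-identityʳ x)

+ᵛ-interchange : (w x y z : Point d) → (w +ᵛ x) +ᵛ (y +ᵛ z) ≡ (w +ᵛ y) +ᵛ (x +ᵛ z)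
+ᵛ-interchange []      []      []      []      = refl
+ᵛ-interchange (a ∷ w) (b ∷ x) (c ∷ y) (e ∷ z) =
  cong₂ _∷_ (interchange a b c e) (+ᵛ-interchange w x y z)

+ᵛ-cancelˡ : (x : Point d) {y z : Point d} → x +ᵛ y ≡ x +ᵛ z → y ≡ z
+ᵛ-cancelˡ []      {[]}    {[]}    _  = refl
+ᵛ-cancelˡ (a ∷ x) {b ∷ y} {c ∷ z} eq =
  cong₂ _∷_ (+-cancelˡ-≡ a b c (cong head eq)) (+ᵛ-cancelˡ x (cong tail eq))

+ᵛ-conicalˡ : (x y : Point d) → x +ᵛ y ≡ 𝟎 → x ≡ 𝟎
+ᵛ-conicalˡ []      []      _  = refl
+ᵛ-conicalˡ (a ∷ x) (b ∷ y) eq =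
  cong₂ _∷_ (m+n≡0⇒m≡0 a (cong head eq)) (+ᵛ-conicalˡ x y (cong tail eq))

double≢𝟎 : {t : Point d} → t ≢ 𝟎 → t +ᵛ t ≢ 𝟎
double≢𝟎 {t = t} t≢𝟎 2t≡𝟎 = t≢𝟎 (+ᵛ-conicalˡ t t 2t≡𝟎)

double-regroup : (m t : Point d) → (m +ᵛ t) +ᵛ (m +ᵛ t) ≡ m +ᵛ (m +ᵛ (t +ᵛ t))
double-regroup m t = trans (+ᵛ-interchange m t m t) (+ᵛ-assoc m m (t +ᵛ t))

+ᵛ-∸ᵛ-cancel : (x z : Point d) → x ≤ᵛ x +ᵛ z × (x +ᵛ z) ∸ᵛ x ≡ z
+ᵛ-∸ᵛ-cancel []      []      = [] , refl
+ᵛ-∸ᵛ-cancel (a ∷ x) (c ∷ z) with +ᵛ-∸ᵛ-cancel x z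
... | x≤ , eq = m≤m+n a c ∷ x≤ , cong₂ _∷_ (m+n∸m≡n a c) eq

+ᵛ-∸ᵛ : {x f : Point d} → x ≤ᵛ f → x +ᵛ (f ∸ᵛ x) ≡ f
+ᵛ-∸ᵛ []       = refl
+ᵛ-∸ᵛ (p ∷ ps) = cong₂ _∷_ (m+[n∸m]≡n p) (+ᵛ-∸ᵛ ps)

∸ᵛ-unique : {x z f : Point d} → x +ᵛ z ≡ f → f ∸ᵛ x ≡ z
∸ᵛ-unique {x = x} {z} refl = proj₂ (+ᵛ-∸ᵛ-cancel x z)

_≟ᵛ_ : (x y : Point d) → Dec (x ≡ y)
_≟ᵛ_ = ≡-dec _≟_

∣_∣ : Point d → ℕ
∣_∣ = sum

∣+ᵛ∣ : (x y : Point d) → ∣ x +ᵛ y ∣ ≡ ∣ x ∣ + ∣ y ∣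
∣+ᵛ∣ []      []      = refl
∣+ᵛ∣ (a ∷ x) (b ∷ y) = trans (cong ((a + b) +_) (∣+ᵛ∣ x y)) (interchange a b ∣ x ∣ ∣ y ∣)

∣∣≡0⇒≡𝟎 : (x : Point d) → ∣ x ∣ ≡ 0 → x ≡ 𝟎
∣∣≡0⇒≡𝟎 []      _  = refl
∣∣≡0⇒≡𝟎 (a ∷ x) eq = cong₂ _∷_ (m+n≡0⇒m≡0 a eq) (∣∣≡0⇒≡𝟎 x (m+n≡0⇒n≡0 a eq))

norm-grows : (x : Point d) {t : Point d} → t ≢ 𝟎 → ∣ x ∣ < ∣ x +ᵛ t ∣
norm-grows x {t} t≢𝟎 = subst (∣ x ∣ <_) (sym (∣+ᵛ∣ x t))
  (m<m+n ∣ x ∣ (n≢0⇒n>0 (λ ∣t∣≡0 → t≢𝟎 (∣∣≡0⇒≡𝟎 t ∣t∣≡0))))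

+ᵛ-no-fixpoint : (x : Point d) {t : Point d} → t ≢ 𝟎 → x +ᵛ t ≢ x
+ᵛ-no-fixpoint x t≢𝟎 eq = <-irrefl (cong ∣_∣ (sym eq)) (norm-grows x t≢𝟎)

maximal-witness : {A : Set} (μ : A → ℕ) {P : Pred A 0ℓ} → Decidable P →
  (xs : List A) → (∀ {x} → P x → x ∈ xs) →
  ∀ {a} → P a → ∃ λ m → P m × (∀ {y} → P y → μ y ≤ μ m)
maximal-witness μ P? xs P⊆xs {a} Pa =
  argmax μ a candidates , argmax-all μ Pa (all-filter P? xs) ,
  λ Py → lookup (f[xs]≤f[argmax] a candidates) (∈-filter⁺ P? (P⊆xs Py) Py)
  where candidates = filter P? xs

module _ {S : Subset d} (G : IsGNS S) where
  open IsGNS G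

  -- Membership in a GNS is decidable, because its complement is a finite list.
  member? : Decidable S
  member? x with H⊆holes x
  ... | inj₁ x∈S  = yes x∈S
  ... | inj₂ hole = no (holes⊆H x hole)

  gap∈holes : ∀ {x} → H S x → x ∈ holes
  gap∈holes {x} x∉S with H⊆holes x
  ... | inj₁ x∈S  = ⊥-elim (x∉S x∈S)
  ... | inj₂ hole = hole

  gap≢𝟎 : ∀ {x} → H S x → x ≢ 𝟎
  gap≢𝟎 x∉S refl = x∉S zero∈

  maximal-gap : {P : Subset d} → Decidable P → (∀ {x} → P x → H S x) →
    ∀ {a} → P a → ∃ λ m → P m × (∀ {y} → P y → ∣ y ∣ ≤ ∣ m ∣)
  maximal-gap P? P⊆H = maximal-witness ∣_∣ P? holes (λ Px → gap∈holes (P⊆H Px))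

-- A gap g of S such that S ∪ {g} is again a submonoid.
record Special (S : Subset d) (g : Point d) : Set where
  field
    gap          : H S g
    shift-closed : ∀ s → S s → s ≢ 𝟎 → S (g +ᵛ s)
    double-in    : S (g +ᵛ g)

_∪｛_｝ : Subset d → Point d → Subset d
(S ∪｛ g ｝) x = S x ⊎ x ≡ g

adjoin-special : {S : Subset d} {g : Point d} → IsGNS S → Special S g → IsGNS (S ∪｛ g ｝)
adjoin-special {S = S} {g} G sp = record
  { zero∈    = inj₁ zero∈
  ; +-closed = closed
  ; holes    = filter other? holes
  ; holes⊆H  = λ x x∈ → let (hole , x≢g) = ∈-filter⁻ other? x∈ in
      λ { (inj₁ x∈S) → holes⊆H x hole x∈S ; (inj₂ x≡g) → x≢g x≡g }
  ; H⊆holes  = covered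
  }
  where
  open IsGNS G
  open Special sp

  other? : Decidable (_≢ g)
  other? x = ¬? (x ≟ᵛ g)

  shift : ∀ s → S s → (S ∪｛ g ｝) (g +ᵛ s)
  shift s s∈S with s ≟ᵛ 𝟎
  ... | yes refl = inj₂ (+ᵛ-identityʳ g)
  ... | no s≢𝟎   = inj₁ (shift-closed s s∈S s≢𝟎)

  closed : ∀ x y → (S ∪｛ g ｝) x → (S ∪｛ g ｝) y → (S ∪｛ g ｝) (x +ᵛ y)
  closed x y (inj₁ x∈S)  (inj₁ y∈S)  = inj₁ (+-closed x y x∈S y∈S)
  closed x _ (inj₁ x∈S)  (inj₂ refl) = subst (S ∪｛ g ｝) (+ᵛ-comm g x) (shift x x∈S)
  closed _ y (inj₂ refl) (inj₁ y∈S)  = shift y y∈S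
  closed _ _ (inj₂ refl) (inj₂ refl) = inj₁ double-in

  covered : ∀ x → (S ∪｛ g ｝) x ⊎ x ∈ filter other? holes
  covered x with H⊆holes x | x ≟ᵛ g
  ... | inj₁ x∈S  | _        = inj₁ (inj₁ x∈S)
  ... | inj₂ _    | yes x≡g  = inj₁ (inj₂ x≡g)
  ... | inj₂ hole | no x≢g   = inj₂ (∈-filter⁺ other? hole x≢g)

-- An irreducible GNS has no two distinct special gaps: S = (S ∪ {f}) ∩ (S ∪ {m}).
two-special-gaps-reducible : {S : Subset d} {f m : Point d} → IsGNS S →
  Special S f → Special S m → f ≢ m → ¬ Irreducible S
two-special-gaps-reducible {S = S} {f} {m} G sf sm f≢m irreducible =
  irreducible (S ∪｛ f ｝ , S ∪｛ m ｝ , adjoin-special G sf , adjoin-special G sm ,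
               ((λ _ → inj₁) , f , inj₂ refl , Special.gap sf) ,
               ((λ _ → inj₁) , m , inj₂ refl , Special.gap sm) , intersection)
  where
  intersection : IsIntersection S (S ∪｛ f ｝) (S ∪｛ m ｝)
  intersection x = (λ x∈S → inj₁ x∈S , inj₁ x∈S) , λ
    { (inj₁ x∈S , _)           → x∈S
    ; (_ , inj₁ x∈S)           → x∈S
    ; (inj₂ refl , inj₂ x≡m)   → ⊥-elim (f≢m x≡m) }

-- A gap of maximal norm is special: every point of larger norm lies in S.
maximal-gap-special : {S : Subset d} {f : Point d} → IsGNS S → H S f →
  (∀ {y} → H S y → ∣ y ∣ ≤ ∣ f ∣) → Special S f
maximal-gap-special {S = S} {f} G f∉S f-max = record
  { gap          = f∉S
  ; shift-closed = λ s _ s≢𝟎 → beyond (norm-grows f s≢𝟎)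
  ; double-in    = beyond (norm-grows f (gap≢𝟎 G f∉S))
  }
  where
  beyond : ∀ {x} → ∣ f ∣ < ∣ x ∣ → S x
  beyond {x} f<x with member? G x
  ... | yes x∈S = x∈S
  ... | no x∉S  = ⊥-elim (<⇒≱ f<x (f-max x∉S))

-- f − h ∈ S  (with h ≤ f, so that the truncated difference is the real one)
Diff∈ : Subset d → Point d → Point d → Set
Diff∈ S f h = h ≤ᵛ f × S (f ∸ᵛ h)

diff∈-intro : {S : Subset d} {h z f : Point d} → h +ᵛ z ≡ f → S z → Diff∈ S f h
diff∈-intro {S = S} {h} {z} refl z∈S =
  proj₁ (+ᵛ-∸ᵛ-cancel h z) , subst S (sym (proj₂ (+ᵛ-∸ᵛ-cancel h z))) z∈S

Harmless : Subset d → Point d → Point d → Set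
Harmless S f h = h +ᵛ h ≡ f ⊎ Diff∈ S f h

Bad : Subset d → Point d → Point d → Set
Bad S f h = H S h × ¬ Harmless S f h

harmless? : {S : Subset d} → IsGNS S → (f h : Point d) → Dec (Harmless S f h)
harmless? G f h = ((h +ᵛ h) ≟ᵛ f) ⊎-dec (Pointwise.decidable _≤?_ h f ×-dec member? G (f ∸ᵛ h))

maximal-bad-special : {S : Subset d} {f m : Point d} → IsGNS S → Bad S f m →
  (∀ {y} → Bad S f y → ∣ y ∣ ≤ ∣ m ∣) → Special S m
maximal-bad-special {S = S} {f} {m} G (m∉S , m-bad) m-max = record
  { gap = m∉S ; shift-closed = shift ; double-in = double }
  where
  open IsGNS G

  no-complement : ∀ {z} → m +ᵛ z ≡ f → ¬ S z
  no-complement m+z≡f z∈S = m-bad (inj₂ (diff∈-intro m+z≡f z∈S))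

  above : ∀ t → t ≢ 𝟎 → S (m +ᵛ t) ⊎ Harmless S f (m +ᵛ t)
  above t t≢𝟎 with member? G (m +ᵛ t) | harmless? G f (m +ᵛ t)
  ... | yes in-S | _            = inj₁ in-S
  ... | no _     | yes harmless = inj₂ harmless
  ... | no gap   | no bad       = ⊥-elim (<⇒≱ (norm-grows m t≢𝟎) (m-max (gap , bad)))

  half-regroupˡ : ∀ {t} → (m +ᵛ t) +ᵛ (m +ᵛ t) ≡ f → m +ᵛ (m +ᵛ (t +ᵛ t)) ≡ f
  half-regroupˡ {t} half = trans (sym (double-regroup m t)) half

  half-regroupʳ : ∀ {t} → (m +ᵛ t) +ᵛ (m +ᵛ t) ≡ f → (m +ᵛ (t +ᵛ t)) +ᵛ m ≡ f
  half-regroupʳ half = trans (+ᵛ-comm _ m) (half-regroupˡ half)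

  -- f = 2(m + t) is impossible for t ≠ 0: the point m + 2t is neither in S
  -- (else f − m ∈ S), nor half of f (else 2t = 0), nor has f − (m + 2t) = m ∈ S.
  not-half : ∀ t → t ≢ 𝟎 → (m +ᵛ t) +ᵛ (m +ᵛ t) ≢ f
  not-half t t≢𝟎 half with above (t +ᵛ t) (double≢𝟎 t≢𝟎)
  ... | inj₁ in-S                = no-complement (half-regroupˡ half) in-S
  ... | inj₂ (inj₁ half′)        = +ᵛ-no-fixpoint m (double≢𝟎 t≢𝟎)
                                     (+ᵛ-cancelˡ (m +ᵛ (t +ᵛ t)) (trans half′ (sym (half-regroupʳ half))))
  ... | inj₂ (inj₂ (_ , rest∈S)) = m∉S (subst S (∸ᵛ-unique (half-regroupʳ half)) rest∈S)

  -- m + s ∈ S: otherwise 2(m + s) = f, or f − m = s + (f − (m + s)) ∈ S.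
  shift : ∀ s → S s → s ≢ 𝟎 → S (m +ᵛ s)
  shift s s∈S s≢𝟎 with above s s≢𝟎
  ... | inj₁ in-S                = in-S
  ... | inj₂ (inj₁ half)         = ⊥-elim (not-half s s≢𝟎 half)
  ... | inj₂ (inj₂ (le , r∈S)) =
    ⊥-elim (no-complement (trans (sym (+ᵛ-assoc m s _)) (+ᵛ-∸ᵛ le)) (+-closed s _ s∈S r∈S))

  -- 2m ∈ S: otherwise 4m = f, or r = f − 2m ∈ S, where r = 0 gives 2m = f and
  -- r ≠ 0 gives f − m = m + r ∈ S by shift.
  double : S (m +ᵛ m)
  double with above m (gap≢𝟎 G m∉S)
  ... | inj₁ in-S        = in-S
  ... | inj₂ (inj₁ half) = ⊥-elim (not-half m (gap≢𝟎 G m∉S) half)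
  ... | inj₂ (inj₂ (le , r∈S)) with (f ∸ᵛ (m +ᵛ m)) ≟ᵛ 𝟎
  ...   | yes r≡𝟎 = ⊥-elim (m-bad (inj₁ 2m≡f))
    where
    open ≡-Reasoning
    2m≡f : m +ᵛ m ≡ f
    2m≡f = begin
      m +ᵛ m                          ≡⟨ sym (+ᵛ-identityʳ _) ⟩
      (m +ᵛ m) +ᵛ 𝟎                   ≡⟨ cong ((m +ᵛ m) +ᵛ_) (sym r≡𝟎) ⟩
      (m +ᵛ m) +ᵛ (f ∸ᵛ (m +ᵛ m))     ≡⟨ +ᵛ-∸ᵛ le ⟩
      f                               ∎
  ...   | no r≢𝟎  = ⊥-elim (no-complement (trans (sym (+ᵛ-assoc m m _)) (+ᵛ-∸ᵛ le))
                                          (shift _ r∈S r≢𝟎))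

Condition : Subset d → Point d → Set
Condition S f = ∀ h → H S h → h +ᵛ h ≢ f → Diff∈ S f h

-- (⇒) For a gap f of maximal norm no gap is bad, since a maximal bad gap would
-- be a second special gap.
irreducible⇒condition : {S : Subset d} → IsGNS S → Irreducible S →
  (∃ λ x → H S x) → ∃ λ f → H S f × Condition S f
irreducible⇒condition {S = S} G irreducible (_ , x∉S)
  with maximal-gap G {H S} (λ x → ¬? (member? G x)) (λ gap → gap) x∉S
... | f , f∉S , f-max = f , f∉S , condition
  where
  f-special : Special S f
  f-special = maximal-gap-special G f∉S f-max

  bad-gap≢f : ∀ {m} → Bad S f m → f ≢ m
  bad-gap≢f (_ , m-bad) refl = m-bad (inj₂ (diff∈-intro {S = S} (+ᵛ-identityʳ f) (IsGNS.zero∈ G)))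

  no-bad-gap : ∀ {h} → ¬ Bad S f h
  no-bad-gap h-bad with maximal-gap G (λ y → ¬? (member? G y) ×-dec ¬? (harmless? G f y)) proj₁ h-bad
  ... | m , m-bad , m-max = two-special-gaps-reducible G f-special
          (maximal-bad-special G m-bad m-max) (bad-gap≢f m-bad) irreducible

  condition : Condition S f
  condition h h∉S 2h≢f with harmless? G f h
  ... | yes (inj₁ 2h≡f) = ⊥-elim (2h≢f 2h≡f)
  ... | yes (inj₂ diff) = diff
  ... | no harmful      = ⊥-elim (no-bad-gap (h∉S , harmful))

over-monoid-contains : {S T : Subset d} {f x : Point d} → Condition S f →
  (∀ y z → T y → T z → T (y +ᵛ z)) → (∀ y → S y → T y) → T x → H S x → T f
over-monoid-contains {T = T} {f} {x} condition T-closed S⊆T x∈T x∉S with (x +ᵛ x) ≟ᵛ f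
... | yes 2x≡f = subst T 2x≡f (T-closed x x x∈T x∈T)
... | no 2x≢f with condition x x∉S 2x≢f
...   | x≤f , rest∈S = subst T (+ᵛ-∸ᵛ x≤f) (T-closed x _ x∈T (S⊆T _ rest∈S))

condition⇒irreducible : {S : Subset d} {f : Point d} → H S f → Condition S f → Irreducible S
condition⇒irreducible f∉S condition
  (T , U , GT , GU , (S⊆T , x , x∈T , x∉S) , (S⊆U , y , y∈U , y∉S) , intersection) =
  f∉S (proj₂ (intersection _)
    ( over-monoid-contains condition (IsGNS.+-closed GT) S⊆T x∈T x∉S
    , over-monoid-contains condition (IsGNS.+-closed GU) S⊆U y∈U y∉S ))

mainTheorem11 : ∀ {d : ℕ} (S : Subset d) → IsGNS S → (∃ λ x → H S x) →
    Irreducible S ⇔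
      (∃ λ f → H S f ×
        (∀ h → H S h → h +ᵛ h ≢ f → (h ≤ᵛ f × S (f ∸ᵛ h))))
mainTheorem11 S G has-gap = mk⇔
  (λ irreducible → irreducible⇒condition G irreducible has-gap)
  (λ (f , f∉S , condition) → condition⇒irreducible f∉S condition)
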